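{- Let $G$ be a parity game, $Q\subseteq V$ a weak quasi 0-dominion, $\sigma_0$ a 0-witness for $Q$, and $Q^\star\subseteq Q$ a subset such that $\sigma_0(v)\in Q^\star$ for all $v\in Q^\star\cap V_0$ and $E(v)\subseteq Q^\star$ for all $v\in Q^\star\cap V_1$. Then $Q^\star$ is a 0-dominion.
   Context: Parity game: finite disjoint $V_0,V_1$ (positions of players 0,1), $V=V_0\cup V_1$, move relation $E\subseteq V\times V$ with $E(v)=\{w:(v,w)\in E\}\neq\emptyset$ for all $v$, priority function $p:V\to P$, $P\subset\mathbb{N}$ finite. A positional $\alpha$-strategy on $U\subseteq V$ is $\sigma:U\cap V_\alpha\to V$ with $(v,\sigma(v))\in E$. For strategies $\sigma_0,\sigma_1$ on $U$ and $v\in U$, the play from $v$ in $U$ is the maximal finite or infinite sequence of positions of $U$ starting at $v$ whose successor at a $V_\alpha$ position is given by $\sigma_\alpha$ (it stops when the prescribed successor lies outside $U$). The priority of a finite path is its maximal priority; of an infinite play, the maximal priority occurring infinitely often. $U$ is an $\alpha$-dominion if there is an $\alpha$-strategy on $U$ such that for every $(1-\alpha)$-strategy on $U$ and $v\in U$ the play is infinite and its priority has parity $\alpha$. $Q$ is a weak quasi 0-dominion if there is a 0-strategy $\sigma_0$ on $Q$ (a 0-witness for $Q$) such that for every 1-strategy $\sigma_1$ on $Q$ and $v\in Q$, if the induced play in $Q$ is infinite then its priority is even. -}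

module Defs where

open import Data.Nat using (ℕ; zero; suc; _≤_; _%_)
open import Data.Fin using (Fin; toℕ)
open import Data.Fin.Subset using (Subset; _∈_; _⊆_)
open import Data.Product using (Σ; ∃; _×_; _,_)
open import Relation.Binary.PropositionalEquality using (_≡_)
open import Relation.Nullary using (yes; no)
import Data.Fin as F

Player : Set
Player = Fin 2

opponent : Player → Player
opponent F.zero = F.suc F.zero
opponent (F.suc _) = F.zero

-- A (finite) parity game with positions Fin n.
-- owner v = α  means  v ∈ V_α  (so V_0, V_1 are disjoint and cover V).
record Game : Set₁ where
  field
    n      : ℕ
    owner  : Fin n → Player
    E      : Fin n → Fin n → Set
    E-nonempty : ∀ v → ∃ λ w → E v w
    prio   : Fin n → ℕ

module _ (G : Game) where
  open Game G

  -- A positional α-strategy on U: only its values on U ∩ V_α matter, and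
  -- there they must be legal moves.  (Values elsewhere are irrelevant junk.)
  IsStrategy : Player → Subset n → (Fin n → Fin n) → Set
  IsStrategy α U σ = ∀ v → v ∈ U → owner v ≡ α → E v (σ v)

  step : Player → (Fin n → Fin n) → (Fin n → Fin n) → Fin n → Fin n
  step α σ τ u with owner u F.≟ α
  ... | yes _ = σ u
  ... | no  _ = τ u

  play : Player → (Fin n → Fin n) → (Fin n → Fin n) → Fin n → ℕ → Fin n
  play α σ τ v zero    = v
  play α σ τ v (suc k) = step α σ τ (play α σ τ v k)

  -- The play from v in U is infinite iff every position stays in U
  -- (otherwise it stops at the first prescribed successor outside U).
  InfiniteIn : Subset n → (ℕ → Fin n) → Set
  InfiniteIn U π = ∀ k → π k ∈ U

  IsPlayPriority : (ℕ → Fin n) → ℕ → Set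
  IsPlayPriority π q =
    (∀ N → ∃ λ k → N ≤ k × prio (π k) ≡ q) ×
    (∃ λ N → ∀ k → N ≤ k → prio (π k) ≤ q)

  WonBy : Player → (ℕ → Fin n) → Set
  WonBy α π = ∃ λ q → IsPlayPriority π q × q % 2 ≡ toℕ α

  Dominion : Player → Subset n → Set
  Dominion α U =
    ∃ λ σ → IsStrategy α U σ ×
      (∀ τ → IsStrategy (opponent α) U τ → ∀ v → v ∈ U →
         InfiniteIn U (play α σ τ v) × WonBy α (play α σ τ v))

  ZeroWitness : Subset n → (Fin n → Fin n) → Set
  ZeroWitness Q σ₀ =
    IsStrategy F.zero Q σ₀ ×
    (∀ σ₁ → IsStrategy (F.suc F.zero) Q σ₁ → ∀ v → v ∈ Q →
       InfiniteIn Q (play F.zero σ₀ σ₁ v) → WonBy F.zero (play F.zero σ₀ σ₁ v))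

  WeakQuasiZeroDominion : Subset n → Set
  WeakQuasiZeroDominion Q = ∃ λ σ₀ → ZeroWitness Q σ₀

module Submission where

open import Defs
open import Data.Fin using (Fin; zero; suc)
open import Data.Fin.Subset using (Subset; _∈_; _⊆_)
open import Data.Fin.Subset.Properties using (_∈?_)
open import Data.Nat using (ℕ; zero; suc; _≤_)
open import Data.Product using (∃; _×_; _,_; proj₁; proj₂)
open import Relation.Binary.PropositionalEquality
  using (_≡_; _≢_; refl; sym; trans; cong; subst; module ≡-Reasoning)
open import Relation.Nullary using (yes; no; contradiction)
import Data.Fin as F

-- Against σ₀, Q⋆ is a trap for player 1, so every play from Q⋆ stays in Q⋆ ⊆ Q.
-- Extending player 1's strategy arbitrarily outside Q⋆ gives a strategy on Q
-- inducing the same play; that play is infinite in Q, hence won by the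
-- 0-witness σ₀.

≢⇒opponent : {α β : Player} → β ≢ α → β ≡ opponent α
≢⇒opponent {zero}     {zero}     β≢α = contradiction refl β≢α
≢⇒opponent {zero}     {suc zero} _   = refl
≢⇒opponent {suc zero} {zero}     _   = refl
≢⇒opponent {suc zero} {suc zero} β≢α = contradiction refl β≢α

module _ (G : Game) where
  open Game G

  extendStrategy : Subset n → (Fin n → Fin n) → Fin n → Fin n
  extendStrategy U τ u with u ∈? U
  ... | yes _ = τ u
  ... | no  _ = proj₁ (E-nonempty u)

  extendStrategy-agrees : ∀ U τ {u} → u ∈ U → extendStrategy U τ u ≡ τ u
  extendStrategy-agrees U τ {u} u∈U with u ∈? U
  ... | yes _    = refl
  ... | no  u∉U = contradiction u∈U u∉U

  extendStrategy-isStrategy : ∀ {α U τ} → IsStrategy G α U τ →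
                              ∀ W → IsStrategy G α W (extendStrategy U τ)
  extendStrategy-isStrategy {U = U} τ-legal W u _ owned with u ∈? U
  ... | yes u∈U = τ-legal u u∈U owned
  ... | no  _   = proj₂ (E-nonempty u)

  step-congʳ : ∀ α σ {τ τ′} u → τ u ≡ τ′ u → step G α σ τ u ≡ step G α σ τ′ u
  step-congʳ α σ u τu≡τ′u with owner u F.≟ α
  ... | yes _ = refl
  ... | no  _ = τu≡τ′u

  play-stays : ∀ {α σ τ U} → (∀ u → u ∈ U → step G α σ τ u ∈ U) →
               ∀ v → v ∈ U → InfiniteIn G U (play G α σ τ v)
  play-stays closed v v∈U zero    = v∈U
  play-stays closed v v∈U (suc k) = closed _ (play-stays closed v v∈U k)

  play-congʳ : ∀ {α σ τ τ′ U} → (∀ u → u ∈ U → τ u ≡ τ′ u) →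
               ∀ v → InfiniteIn G U (play G α σ τ v) →
               ∀ k → play G α σ τ v k ≡ play G α σ τ′ v k
  play-congʳ agree v inU zero = refl
  play-congʳ {α} {σ} {τ} {τ′} agree v inU (suc k) = begin
    step G α σ τ  (play G α σ τ  v k) ≡⟨ step-congʳ α σ _ (agree _ (inU k)) ⟩
    step G α σ τ′ (play G α σ τ  v k) ≡⟨ cong (step G α σ τ′) (play-congʳ agree v inU k) ⟩
    step G α σ τ′ (play G α σ τ′ v k) ∎
    where open ≡-Reasoning

  wonBy-cong : ∀ {α} {π π′ : ℕ → Fin n} → (∀ k → π k ≡ π′ k) → WonBy G α π′ → WonBy G α π
  wonBy-cong {π = π} {π′} π≡π′ (q , (recurs , N , bounded) , parity) =
    q , (recurs′ , N , bounded′) , parity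
    where
      recurs′ : ∀ M → ∃ λ k → M ≤ k × prio (π k) ≡ q
      recurs′ M with recurs M
      ... | k , M≤k , prio≡q = k , M≤k , trans (cong prio (π≡π′ k)) prio≡q

      bounded′ : ∀ k → N ≤ k → prio (π k) ≤ q
      bounded′ k N≤k = subst (λ u → prio u ≤ q) (sym (π≡π′ k)) (bounded k N≤k)

  step-trap : ∀ {α σ τ U} →
              (∀ u → u ∈ U → owner u ≡ α → σ u ∈ U) →
              (∀ u → u ∈ U → owner u ≡ opponent α → ∀ w → E u w → w ∈ U) →
              IsStrategy G (opponent α) U τ →
              ∀ u → u ∈ U → step G α σ τ u ∈ U
  step-trap {α} σ-closed E-closed τ-legal u u∈U with owner u F.≟ α
  ... | yes owned = σ-closed u u∈U owned
  ... | no  ¬owned = E-closed u u∈U (≢⇒opponent ¬owned) _ (τ-legal u u∈U (≢⇒opponent ¬owned))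

corollary9 : (G : Game) → (Q Q⋆ : Subset (Game.n G)) → (σ₀ : Fin (Game.n G) → Fin (Game.n G)) →
    WeakQuasiZeroDominion G Q → ZeroWitness G Q σ₀ → Q⋆ ⊆ Q →
    (∀ v → v ∈ Q⋆ → Game.owner G v ≡ zero → σ₀ v ∈ Q⋆) →
    (∀ v → v ∈ Q⋆ → Game.owner G v ≡ suc zero → ∀ w → Game.E G v w → w ∈ Q⋆) →
    Dominion G zero Q⋆
corollary9 G Q Q⋆ σ₀ _ (σ₀-legal , σ₀-wins) Q⋆⊆Q σ₀-closed E-closed =
  σ₀ , (λ v v∈Q⋆ → σ₀-legal v (Q⋆⊆Q v∈Q⋆)) , wins
  where
    wins : ∀ τ → IsStrategy G (suc zero) Q⋆ τ → ∀ v → v ∈ Q⋆ →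
           InfiniteIn G Q⋆ (play G zero σ₀ τ v) × WonBy G zero (play G zero σ₀ τ v)
    wins τ τ-legal v v∈Q⋆ = inQ⋆ , wonBy-cong G same (σ₀-wins τ′ τ′-legal v (Q⋆⊆Q v∈Q⋆) inQ)
      where
        τ′ : Fin (Game.n G) → Fin (Game.n G)
        τ′ = extendStrategy G Q⋆ τ

        τ′-legal : IsStrategy G (suc zero) Q τ′
        τ′-legal = extendStrategy-isStrategy G τ-legal Q

        inQ⋆ : InfiniteIn G Q⋆ (play G zero σ₀ τ v)
        inQ⋆ = play-stays G (step-trap G σ₀-closed E-closed τ-legal) v v∈Q⋆

        same : ∀ k → play G zero σ₀ τ v k ≡ play G zero σ₀ τ′ v k
        same = play-congʳ G (λ u u∈Q⋆ → sym (extendStrategy-agrees G Q⋆ τ u∈Q⋆)) v inQ⋆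

        inQ : InfiniteIn G Q (play G zero σ₀ τ′ v)
        inQ k = subst (_∈ Q) (same k) (Q⋆⊆Q (inQ⋆ k))
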